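{- Let $k\ge1$ and $\Upsilon=\{(1\text{ - }2,1~0),(1\text{ - }2,0~1)\}$. Let $A_k^{\Upsilon}(t)=\sum_{n\ge0}Av_{n,k}^{\Upsilon}t^n$ (with $Av_{0,k}^\Upsilon=1$) and $C(t)=\sum_{n\ge1}n!\,t^n$. Then, as formal power series in $t$, $$A_k^{\Upsilon}(t)=\frac{1+C(t)}{1-(k-1)C(t)}.$$
   Context: For integers $k\ge1$, $n\ge0$, $C_k\wr S_n$ denotes the set of pairs $(\sigma,w)$ where $\sigma=\sigma_1\cdots\sigma_n$ is a permutation of $\{1,\dots,n\}$ in one-line notation and $w=w_1\cdots w_n\in\{0,1,\dots,k-1\}^n$. $(\sigma,w)$ bi-avoids $(1\text{ - }2,1~0)$ if there are no $i<j$ with $\sigma_i<\sigma_j$ and $w_i>w_j$, and bi-avoids $(1\text{ - }2,0~1)$ if there are no $i<j$ with $\sigma_i<\sigma_j$ and $w_i<w_j$. $Av_{n,k}^{\Upsilon}$ is the number of elements of $C_k\wr S_n$ bi-avoiding both patterns of $\Upsilon$. -}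

module Defs where

open import Data.Nat using (ℕ; zero; suc; _∸_)
open import Data.Fin using (Fin; toℕ) renaming (_<_ to _<ᶠ_)
open import Data.Fin.Properties using (all?; _≟_) renaming (_<?_ to _<ᶠ?_)
open import Data.Vec using (Vec; []; _∷_; lookup)
open import Data.List using (List; []; _∷_; map; concatMap; allFin; cartesianProduct; filter; length; foldr; upTo)
open import Data.Product using (_×_; _,_; proj₁; proj₂)
open import Data.Integer using (ℤ; +_; _*_; _+_; _-_)
open import Relation.Binary.PropositionalEquality using (_≡_)
open import Relation.Nullary using (¬_; Dec)
open import Relation.Nullary.Decidable using (_→-dec_; _×-dec_; ¬?)

words : (m n : ℕ) → List (Vec (Fin m) n)
words m zero = [] ∷ []
words m (suc n) = concatMap (λ x → map (x ∷_) (words m n)) (allFin m)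

-- σ (one-line notation, values in Fin n ≅ {1,…,n}) is a permutation: injective.
IsPerm : {n : ℕ} → Vec (Fin n) n → Set
IsPerm {n} σ = ∀ (i j : Fin n) → lookup σ i ≡ lookup σ j → i ≡ j

BiAvoids10 : {n k : ℕ} → Vec (Fin n) n → Vec (Fin k) n → Set
BiAvoids10 {n} σ w = ∀ (i j : Fin n) → i <ᶠ j → lookup σ i <ᶠ lookup σ j → ¬ (lookup w j <ᶠ lookup w i)

BiAvoids01 : {n k : ℕ} → Vec (Fin n) n → Vec (Fin k) n → Set
BiAvoids01 {n} σ w = ∀ (i j : Fin n) → i <ᶠ j → lookup σ i <ᶠ lookup σ j → ¬ (lookup w i <ᶠ lookup w j)

Good : {n k : ℕ} → Vec (Fin n) n × Vec (Fin k) n → Set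
Good (σ , w) = IsPerm σ × BiAvoids10 σ w × BiAvoids01 σ w

good? : {n k : ℕ} → (p : Vec (Fin n) n × Vec (Fin k) n) → Dec (Good p)
good? (σ , w) =
  all? (λ i → all? (λ j → (lookup σ i ≟ lookup σ j) →-dec (i ≟ j)))
  ×-dec all? (λ i → all? (λ j → (i <ᶠ? j) →-dec ((lookup σ i <ᶠ? lookup σ j) →-dec ¬? (lookup w j <ᶠ? lookup w i))))
  ×-dec all? (λ i → all? (λ j → (i <ᶠ? j) →-dec ((lookup σ i <ᶠ? lookup σ j) →-dec ¬? (lookup w i <ᶠ? lookup w j))))

Av : (n k : ℕ) → ℕ
Av n k = length (filter good? (cartesianProduct (words n n) (words k n)))

PS : Set
PS = ℕ → ℤ

_⊛_ : PS → PS → PS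
(f ⊛ g) n = foldr _+_ (+ 0) (map (λ i → f i * g (n ∸ i)) (upTo (suc n)))

factorial : ℕ → ℕ
factorial zero = 1
factorial (suc n) = suc n Data.Nat.* factorial n

A : ℕ → PS
A k n = + Av n k

C : PS
C zero = + 0
C (suc n) = + factorial (suc n)

one : PS
one zero = + 1
one (suc n) = + 0

_ : Av 0 3 ≡ 1
_ = Relation.Binary.PropositionalEquality.refl

module Submission where

-- (σ , w) bi-avoids both patterns iff σ is a permutation and w is constant on every non-inversion
-- i < j, σ i < σ j; call such pairs admissible. Removing the first entry v, of colour c, leaves an
-- admissible pair in which every entry above v has colour c. Hence the number of admissible pairs
-- of size N whose entries ≥ a all carry a prescribed colour depends only on N and a, and obeys a
-- recurrence in which a becomes a ⊓ v. Writing T m s for this number with N = s + m and a = m, a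
-- double induction on the size gives T m s = (s + m)! + (k − 1) ∑_{j + d = m, d ≥ 1} T j s · d!.
-- At s = 0 this is Av n = n! + (k − 1) ∑_{j + d = n} Av j · C d, the coefficients of
-- A · (1 − (k − 1) C) = 1 + C.

open import Defs
open import Data.Nat using (ℕ; _≤_; _∸_)
open import Relation.Binary.PropositionalEquality using (_≡_)

module Counting where

  open import Data.Nat using (zero; suc; _+_; _*_; _<_; _⊓_; _≤?_; z≤n; s≤s)
  open import Data.Nat.Properties hiding (_≟_)
  open import Data.Nat.Tactic.RingSolver using (solve-∀)
  open import Data.Nat.ListAction using () renaming (sum to sumᴸ)
  open import Data.Nat.ListAction.Properties using () renaming (sum-++ to sumᴸ-++)
  open import Data.Fin as Fin using (Fin; zero; suc; toℕ; punchIn; punchOut; fromℕ<)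
  import Data.Fin.Properties as Finₚ
  open Finₚ using (_≟_)
  open import Data.Vec as Vec using (Vec; []; _∷_; lookup)
  open import Data.Vec.Properties using (lookup-map)
  open import Data.List using (List; []; _∷_; _++_; map; concatMap; cartesianProduct; filter; length; allFin; tabulate)
  open import Data.List.Properties using (map-++; map-∘; map-cong; map-tabulate)
  open import Data.Product using (_×_; _,_; ∃; proj₁; proj₂)
  open import Data.Sum using (_⊎_; inj₁; inj₂)
  open import Function using (_∘_; _⇔_; mk⇔; Equivalence)
  open import Relation.Nullary using (¬_; Dec; yes; no; contradiction)
  open import Relation.Nullary.Decidable using (_×-dec_; _→-dec_; ¬?)
  open import Relation.Unary using (Decidable)
  open import Relation.Binary.PropositionalEquality using (refl; sym; trans; cong; cong₂; subst; subst₂; _≢_; module ≡-Reasoning)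
  open import Relation.Binary.Definitions using (tri<; tri≈; tri>)
  open import Algebra.Properties.Semiring.Sum +-*-semiring
    using (sum-syntax; sum-cong-≗; sum-remove; sum-replicate-zero; ∑-comm; *-distribˡ-sum)

  open ≡-Reasoning

  private
    variable
      I J : Set
      P Q : Set
      a k m n N : ℕ

  χ : Dec P → ℕ
  χ (yes _) = 1
  χ (no _)  = 0

  χ-cong : P ⇔ Q → (p? : Dec P) (q? : Dec Q) → χ p? ≡ χ q?
  χ-cong P⇔Q (yes p) (yes q) = refl
  χ-cong P⇔Q (yes p) (no ¬q) = contradiction (Equivalence.to P⇔Q p) ¬q
  χ-cong P⇔Q (no ¬p) (yes q) = contradiction (Equivalence.from P⇔Q q) ¬p
  χ-cong P⇔Q (no ¬p) (no ¬q) = refl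

  χ-× : (p? : Dec P) (q? : Dec Q) → χ (p? ×-dec q?) ≡ χ p? * χ q?
  χ-× (yes _) (yes _) = refl
  χ-× (yes _) (no _)  = refl
  χ-× (no _)  (yes _) = refl
  χ-× (no _)  (no _)  = refl

  χ-yes : P → (p? : Dec P) → χ p? ≡ 1
  χ-yes p (yes _) = refl
  χ-yes p (no ¬p) = contradiction p ¬p

  χ-no : ¬ P → (p? : Dec P) → χ p? ≡ 0
  χ-no ¬p (yes p) = contradiction p ¬p
  χ-no ¬p (no _)  = refl

  χ-*-cong : (p? : Dec P) {x y : ℕ} → (P → x ≡ y) → χ p? * x ≡ χ p? * y
  χ-*-cong (yes p) x≡y = cong (_+ 0) (x≡y p)
  χ-*-cong (no _)  x≡y = refl

  ∑-const : ∀ n c → ∑[ i < n ] c ≡ n * c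
  ∑-const zero    c = refl
  ∑-const (suc n) c = cong (c +_) (∑-const n c)

  ∑-δ : (c₀ : Fin k) (x : ℕ) → ∑[ c < k ] (χ (c ≟ c₀) * x) ≡ x
  ∑-δ {suc k} c₀ x = begin
    ∑[ c < suc k ] (χ (c ≟ c₀) * x)
      ≡⟨ sum-remove {i = c₀} (λ c → χ (c ≟ c₀) * x) ⟩
    χ (c₀ ≟ c₀) * x + ∑[ c < k ] (χ (punchIn c₀ c ≟ c₀) * x)
      ≡⟨ cong₂ _+_ (cong (_* x) (χ-yes refl (c₀ ≟ c₀))) others ⟩
    1 * x + 0
      ≡⟨ trans (+-identityʳ _) (*-identityˡ x) ⟩
    x ∎
    where
    others : ∑[ c < k ] (χ (punchIn c₀ c ≟ c₀) * x) ≡ 0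
    others = trans (sum-cong-≗ λ c → cong (_* x) (χ-no (Finₚ.punchInᵢ≢i c₀ c) (punchIn c₀ c ≟ c₀)))
                   (sum-replicate-zero k)

  ∑-≢-punchIn : (v : Fin (suc n)) (f : Fin (suc n) → ℕ) →
                ∑[ x < suc n ] (χ (¬? (x ≟ v)) * f x) ≡ ∑[ y < n ] f (punchIn v y)
  ∑-≢-punchIn {n} v f = begin
    ∑[ x < suc n ] (χ (¬? (x ≟ v)) * f x)
      ≡⟨ sum-remove {i = v} (λ x → χ (¬? (x ≟ v)) * f x) ⟩
    χ (¬? (v ≟ v)) * f v + ∑[ y < n ] (χ (¬? (punchIn v y ≟ v)) * f (punchIn v y))
      ≡⟨ cong₂ _+_ (cong (_* f v) (χ-no (λ v≢v → v≢v refl) (¬? (v ≟ v)))) (sum-cong-≗ kept) ⟩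
    ∑[ y < n ] f (punchIn v y) ∎
    where
    kept : ∀ y → χ (¬? (punchIn v y ≟ v)) * f (punchIn v y) ≡ f (punchIn v y)
    kept y = trans (cong (_* f (punchIn v y)) (χ-yes (Finₚ.punchInᵢ≢i v y) (¬? (punchIn v y ≟ v))))
                   (*-identityˡ _)

  sumWords : (m n : ℕ) → (Vec (Fin m) n → ℕ) → ℕ
  sumWords m zero    f = f []
  sumWords m (suc n) f = ∑[ x < m ] sumWords m n (λ xs → f (x ∷ xs))

  sumWords-cong : {f g : Vec (Fin m) n → ℕ} → (∀ xs → f xs ≡ g xs) → sumWords m n f ≡ sumWords m n g
  sumWords-cong {n = zero}  f≗g = f≗g []
  sumWords-cong {m} {n = suc n} f≗g = sum-cong-≗ (λ x → sumWords-cong {m} {n} (λ xs → f≗g (x ∷ xs)))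

  *-distribˡ-sumWords : ∀ c (f : Vec (Fin m) n → ℕ) → c * sumWords m n f ≡ sumWords m n (λ xs → c * f xs)
  *-distribˡ-sumWords {n = zero}  c f = refl
  *-distribˡ-sumWords {m} {n = suc n} c f =
    trans (*-distribˡ-sum c (λ x → sumWords m n (λ xs → f (x ∷ xs))))
          (sum-cong-≗ λ x → *-distribˡ-sumWords {m} {n} c (λ xs → f (x ∷ xs)))

  sumWords-∑-comm : (f : Vec (Fin m) n → Fin k → ℕ) →
                    sumWords m n (λ xs → ∑[ c < k ] f xs c) ≡ ∑[ c < k ] sumWords m n (λ xs → f xs c)
  sumWords-∑-comm {n = zero}  f = refl
  sumWords-∑-comm {m} {n = suc n} {k} f =
    trans (sum-cong-≗ λ x → sumWords-∑-comm {m} {n} {k} (λ xs → f (x ∷ xs)))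
          (∑-comm {m} {k} λ x c → sumWords m n (λ xs → f (x ∷ xs) c))

  sumᴸ-tabulate : (f : Fin n → ℕ) → sumᴸ (tabulate f) ≡ ∑[ i < n ] f i
  sumᴸ-tabulate {zero}  f = refl
  sumᴸ-tabulate {suc n} f = cong (f zero +_) (sumᴸ-tabulate (f ∘ suc))

  sumᴸ-map-++ : (f : I → ℕ) (xs ys : List I) → sumᴸ (map f (xs ++ ys)) ≡ sumᴸ (map f xs) + sumᴸ (map f ys)
  sumᴸ-map-++ f xs ys = trans (cong sumᴸ (map-++ f xs ys)) (sumᴸ-++ (map f xs) _)

  sumᴸ-concatMap : (f : J → ℕ) (g : I → List J) (xs : List I) →
                   sumᴸ (map f (concatMap g xs)) ≡ sumᴸ (map (λ x → sumᴸ (map f (g x))) xs)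
  sumᴸ-concatMap f g []       = refl
  sumᴸ-concatMap f g (x ∷ xs) = trans (sumᴸ-map-++ f (g x) _) (cong (sumᴸ (map f (g x)) +_) (sumᴸ-concatMap f g xs))

  sumᴸ-cartesianProduct : (f : I × J → ℕ) (xs : List I) (ys : List J) →
    sumᴸ (map f (cartesianProduct xs ys)) ≡ sumᴸ (map (λ x → sumᴸ (map (λ y → f (x , y)) ys)) xs)
  sumᴸ-cartesianProduct f []       ys = refl
  sumᴸ-cartesianProduct f (x ∷ xs) ys = trans (sumᴸ-map-++ f (map (x ,_) ys) _)
    (cong₂ _+_ (cong sumᴸ (sym (map-∘ {g = f} {f = x ,_} ys))) (sumᴸ-cartesianProduct f xs ys))

  sumᴸ-words : ∀ m n (f : Vec (Fin m) n → ℕ) → sumᴸ (map f (words m n)) ≡ sumWords m n f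
  sumᴸ-words m zero    f = +-identityʳ (f [])
  sumᴸ-words m (suc n) f = begin
    sumᴸ (map f (concatMap (λ x → map (x ∷_) (words m n)) (allFin m)))
      ≡⟨ sumᴸ-concatMap f _ (allFin m) ⟩
    sumᴸ (map (λ x → sumᴸ (map f (map (x ∷_) (words m n)))) (allFin m))
      ≡⟨ cong sumᴸ (map-tabulate (λ x → x) (λ x → sumᴸ (map f (map (x ∷_) (words m n))))) ⟩
    sumᴸ (tabulate (λ x → sumᴸ (map f (map (x ∷_) (words m n)))))
      ≡⟨ sumᴸ-tabulate {m} _ ⟩
    ∑[ x < m ] sumᴸ (map f (map (x ∷_) (words m n)))
      ≡⟨ sum-cong-≗ (λ x → trans (cong sumᴸ (sym (map-∘ {g = f} {f = x ∷_} (words m n)))) (sumᴸ-words m n _)) ⟩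
    ∑[ x < m ] sumWords m n (λ xs → f (x ∷ xs)) ∎

  length-filter≡sum-χ : {P : I → Set} (P? : Decidable P) (xs : List I) → length (filter P? xs) ≡ sumᴸ (map (χ ∘ P?) xs)
  length-filter≡sum-χ P? []       = refl
  length-filter≡sum-χ P? (x ∷ xs) with P? x
  ... | yes _ = cong suc (length-filter≡sum-χ P? xs)
  ... | no _  = length-filter≡sum-χ P? xs

  Av≡sumWords : ∀ n k → Av n k ≡ sumWords n n (λ σ → sumWords k n (λ w → χ (good? (σ , w))))
  Av≡sumWords n k = begin
    length (filter good? (cartesianProduct (words n n) (words k n)))
      ≡⟨ length-filter≡sum-χ good? (cartesianProduct (words n n) (words k n)) ⟩
    sumᴸ (map (χ ∘ good?) (cartesianProduct (words n n) (words k n)))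
      ≡⟨ sumᴸ-cartesianProduct (χ ∘ good?) (words n n) (words k n) ⟩
    sumᴸ (map (λ σ → sumᴸ (map (λ w → χ (good? (σ , w))) (words k n))) (words n n))
      ≡⟨ cong sumᴸ (map-cong (λ σ → sumᴸ-words k n _) (words n n)) ⟩
    sumᴸ (map (λ σ → sumWords k n (λ w → χ (good? (σ , w)))) (words n n))
      ≡⟨ sumᴸ-words n n _ ⟩
    sumWords n n (λ σ → sumWords k n (λ w → χ (good? (σ , w)))) ∎

  antidiagonal : ℕ → (ℕ → ℕ → ℕ) → ℕ
  antidiagonal zero    f = f 0 0
  antidiagonal (suc n) f = f 0 (suc n) + antidiagonal n (λ a b → f (suc a) b)

  syntax antidiagonal n (λ a b → x) = ∑[ a + b ≡ n ] x

  antidiagonal-cong′ : ∀ n {f g : ℕ → ℕ → ℕ} → (∀ a b → a + b ≡ n → f a b ≡ g a b) →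
                       ∑[ a + b ≡ n ] f a b ≡ ∑[ a + b ≡ n ] g a b
  antidiagonal-cong′ zero    f≗g = f≗g 0 0 refl
  antidiagonal-cong′ (suc n) f≗g =
    cong₂ _+_ (f≗g 0 (suc n) refl) (antidiagonal-cong′ n (λ a b eq → f≗g (suc a) b (cong suc eq)))

  antidiagonal-cong : ∀ n {f g : ℕ → ℕ → ℕ} → (∀ a b → f a b ≡ g a b) →
                      ∑[ a + b ≡ n ] f a b ≡ ∑[ a + b ≡ n ] g a b
  antidiagonal-cong n f≗g = antidiagonal-cong′ n (λ a b _ → f≗g a b)

  antidiagonal-distrib-+ : ∀ n (f g : ℕ → ℕ → ℕ) →
    ∑[ a + b ≡ n ] (f a b + g a b) ≡ (∑[ a + b ≡ n ] f a b) + ∑[ a + b ≡ n ] g a b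
  antidiagonal-distrib-+ zero    f g = refl
  antidiagonal-distrib-+ (suc n) f g =
    trans (cong (f 0 (suc n) + g 0 (suc n) +_) (antidiagonal-distrib-+ n _ _)) (+-+-comm (f 0 (suc n)) _ _ _)
    where
    +-+-comm : ∀ w x y z → w + x + (y + z) ≡ w + y + (x + z)
    +-+-comm = solve-∀

  antidiagonal-*ˡ : ∀ n c (f : ℕ → ℕ → ℕ) → ∑[ a + b ≡ n ] (c * f a b) ≡ c * ∑[ a + b ≡ n ] f a b
  antidiagonal-*ˡ zero    c f = refl
  antidiagonal-*ˡ (suc n) c f =
    trans (cong (c * f 0 (suc n) +_) (antidiagonal-*ˡ n c _)) (sym (*-distribˡ-+ c (f 0 (suc n)) _))

  antidiagonal-*ʳ : ∀ n c (f : ℕ → ℕ → ℕ) → ∑[ a + b ≡ n ] (f a b * c) ≡ (∑[ a + b ≡ n ] f a b) * c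
  antidiagonal-*ʳ n c f =
    trans (antidiagonal-cong n (λ a b → *-comm (f a b) c)) (trans (antidiagonal-*ˡ n c f) (*-comm c _))

  antidiagonal-const : ∀ n c → ∑[ a + b ≡ n ] c ≡ suc n * c
  antidiagonal-const zero    c = sym (+-identityʳ c)
  antidiagonal-const (suc n) c = cong (c +_) (antidiagonal-const n c)

  antidiagonal-last : ∀ n (f : ℕ → ℕ → ℕ) →
    ∑[ a + b ≡ suc n ] f a b ≡ (∑[ a + b ≡ n ] f a (suc b)) + f (suc n) 0
  antidiagonal-last zero    f = refl
  antidiagonal-last (suc n) f =
    trans (cong (f 0 (suc (suc n)) +_) (antidiagonal-last n (λ a b → f (suc a) b))) (sym (+-assoc (f 0 (suc (suc n))) _ _))

  antidiagonal-comm : ∀ n (f : ℕ → ℕ → ℕ) → ∑[ a + b ≡ n ] f a b ≡ ∑[ a + b ≡ n ] f b a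
  antidiagonal-comm zero    f = refl
  antidiagonal-comm (suc n) f = begin
    f 0 (suc n) + ∑[ a + b ≡ n ] f (suc a) b   ≡⟨ cong (f 0 (suc n) +_) (antidiagonal-comm n (λ a b → f (suc a) b)) ⟩
    f 0 (suc n) + ∑[ a + b ≡ n ] f (suc b) a   ≡⟨ +-comm (f 0 (suc n)) _ ⟩
    (∑[ a + b ≡ n ] f (suc b) a) + f 0 (suc n) ≡⟨ antidiagonal-last n (λ a b → f b a) ⟨
    ∑[ a + b ≡ suc n ] f b a                   ∎

  antidiagonal-assoc : ∀ n (f : ℕ → ℕ → ℕ → ℕ) →
    ∑[ r + c ≡ n ] ∑[ a + b ≡ r ] f a b c ≡ ∑[ a + r ≡ n ] ∑[ b + c ≡ r ] f a b c
  antidiagonal-assoc zero    f = refl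
  antidiagonal-assoc (suc n) f = trans (cong (f 0 0 (suc n) +_) (begin
    ∑[ r + c ≡ n ] (f 0 (suc r) c + ∑[ a + b ≡ r ] f (suc a) b c)
      ≡⟨ antidiagonal-distrib-+ n (λ r c → f 0 (suc r) c) (λ r c → ∑[ a + b ≡ r ] f (suc a) b c) ⟩
    (∑[ r + c ≡ n ] f 0 (suc r) c) + ∑[ r + c ≡ n ] ∑[ a + b ≡ r ] f (suc a) b c
      ≡⟨ cong (∑[ r + c ≡ n ] f 0 (suc r) c +_) (antidiagonal-assoc n (λ a → f (suc a))) ⟩
    (∑[ r + c ≡ n ] f 0 (suc r) c) + ∑[ a + r ≡ n ] ∑[ b + c ≡ r ] f (suc a) b c ∎))
    (sym (+-assoc (f 0 0 (suc n)) _ _))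

  antidiagonal-reassoc : ∀ n (f : ℕ → ℕ → ℕ → ℕ) →
    ∑[ r + c ≡ n ] ∑[ a + b ≡ r ] f a b c ≡ ∑[ r + b ≡ n ] ∑[ a + c ≡ r ] f a b c
  antidiagonal-reassoc n f = begin
    ∑[ r + c ≡ n ] ∑[ a + b ≡ r ] f a b c ≡⟨ antidiagonal-assoc n f ⟩
    ∑[ a + r ≡ n ] ∑[ b + c ≡ r ] f a b c ≡⟨ antidiagonal-cong n (λ a r → antidiagonal-comm r (f a)) ⟩
    ∑[ a + r ≡ n ] ∑[ c + b ≡ r ] f a b c ≡⟨ antidiagonal-assoc n (λ a c b → f a b c) ⟨
    ∑[ r + b ≡ n ] ∑[ a + c ≡ r ] f a b c ∎

  ∑-toℕ≡antidiagonal : ∀ n (h : ℕ → ℕ) → ∑[ v < suc n ] h (toℕ v) ≡ ∑[ v + e ≡ n ] h v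
  ∑-toℕ≡antidiagonal zero    h = +-identityʳ (h 0)
  ∑-toℕ≡antidiagonal (suc n) h = cong (h 0 +_) (∑-toℕ≡antidiagonal n (h ∘ suc))

  -- Admissible coloured words

  Distinct : Vec (Fin m) n → Set
  Distinct σ = ∀ i j → lookup σ i ≡ lookup σ j → i ≡ j

  MonochromeNonInversions : Vec (Fin m) n → Vec (Fin k) n → Set
  MonochromeNonInversions σ w = ∀ i j → i Fin.< j → lookup σ i Fin.< lookup σ j → lookup w i ≡ lookup w j

  Admissible : Vec (Fin m) n → Vec (Fin k) n → Set
  Admissible σ w = Distinct σ × MonochromeNonInversions σ w

  ColouredAbove : ℕ → Fin k → Vec (Fin m) n → Vec (Fin k) n → Set
  ColouredAbove a c σ w = ∀ j → a ≤ toℕ (lookup σ j) → lookup w j ≡ c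

  Omits : Fin m → Vec (Fin m) n → Set
  Omits v σ = ∀ j → lookup σ j ≢ v

  admissible? : (σ : Vec (Fin m) n) (w : Vec (Fin k) n) → Dec (Admissible σ w)
  admissible? σ w =
    Finₚ.all? (λ i → Finₚ.all? λ j → (lookup σ i ≟ lookup σ j) →-dec (i ≟ j)) ×-dec
    Finₚ.all? (λ i → Finₚ.all? λ j →
      (i Finₚ.<? j) →-dec (lookup σ i Finₚ.<? lookup σ j) →-dec (lookup w i ≟ lookup w j))

  colouredAbove? : ∀ a (c : Fin k) (σ : Vec (Fin m) n) w → Dec (ColouredAbove a c σ w)
  colouredAbove? a c σ w = Finₚ.all? λ j → (a ≤? toℕ (lookup σ j)) →-dec (lookup w j ≟ c)

  omits? : (v : Fin m) (σ : Vec (Fin m) n) → Dec (Omits v σ)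
  omits? v σ = Finₚ.all? λ j → ¬? (lookup σ j ≟ v)

  good⇔admissible : (σ : Vec (Fin n) n) (w : Vec (Fin k) n) → Good (σ , w) ⇔ Admissible σ w
  good⇔admissible σ w = mk⇔
    (λ (distinct , avoids10 , avoids01) →
      distinct , λ i j i<j σi<σj → trichotomy (avoids10 i j i<j σi<σj) (avoids01 i j i<j σi<σj))
    (λ (distinct , mono) → distinct , (λ i j i<j σi<σj → Finₚ.<-irrefl (sym (mono i j i<j σi<σj))) ,
                                      (λ i j i<j σi<σj → Finₚ.<-irrefl (mono i j i<j σi<σj)))
    where
    trichotomy : {x y : Fin k} → ¬ (y Fin.< x) → ¬ (x Fin.< y) → x ≡ y
    trichotomy {x = x} {y} y≮x x≮y with Finₚ.<-cmp x y
    ... | tri< x<y _ _ = contradiction x<y x≮y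
    ... | tri≈ _ x≡y _ = x≡y
    ... | tri> _ _ y<x = contradiction y<x y≮x

  omits-∷ : (v x : Fin m) (σ : Vec (Fin m) n) → Omits v (x ∷ σ) ⇔ (x ≢ v × Omits v σ)
  omits-∷ v x σ = mk⇔ (λ omits → omits zero , omits ∘ suc) λ where
    (x≢v , omits) zero    → x≢v
    (x≢v , omits) (suc j) → omits j

  sumWords-omits : (v : Fin (suc N)) (F : Vec (Fin (suc N)) n → ℕ) →
    sumWords (suc N) n (λ σ → χ (omits? v σ) * F σ) ≡ sumWords N n (λ τ → F (Vec.map (punchIn v) τ))
  sumWords-omits {n = zero} v F = trans (cong (_* F []) (χ-yes (λ ()) (omits? v []))) (*-identityˡ (F []))
  sumWords-omits {N} {suc n} v F = begin
    ∑[ x < suc N ] sumWords (suc N) n (λ σ → χ (omits? v (x ∷ σ)) * F (x ∷ σ))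
      ≡⟨ sum-cong-≗ (λ x → trans (sumWords-cong (split x))
                                 (sym (*-distribˡ-sumWords (χ (¬? (x ≟ v))) (λ σ → χ (omits? v σ) * F (x ∷ σ))))) ⟩
    ∑[ x < suc N ] (χ (¬? (x ≟ v)) * sumWords (suc N) n (λ σ → χ (omits? v σ) * F (x ∷ σ)))
      ≡⟨ ∑-≢-punchIn v (λ x → sumWords (suc N) n (λ σ → χ (omits? v σ) * F (x ∷ σ))) ⟩
    ∑[ y < N ] sumWords (suc N) n (λ σ → χ (omits? v σ) * F (punchIn v y ∷ σ))
      ≡⟨ sum-cong-≗ (λ y → sumWords-omits v (λ σ → F (punchIn v y ∷ σ))) ⟩
    ∑[ y < N ] sumWords N n (λ τ → F (punchIn v y ∷ Vec.map (punchIn v) τ)) ∎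
    where
    split : ∀ x σ → χ (omits? v (x ∷ σ)) * F (x ∷ σ) ≡ χ (¬? (x ≟ v)) * (χ (omits? v σ) * F (x ∷ σ))
    split x σ = begin
      χ (omits? v (x ∷ σ)) * F (x ∷ σ)
        ≡⟨ cong (_* F (x ∷ σ)) (χ-cong (omits-∷ v x σ) (omits? v (x ∷ σ)) (¬? (x ≟ v) ×-dec omits? v σ)) ⟩
      χ (¬? (x ≟ v) ×-dec omits? v σ) * F (x ∷ σ)
        ≡⟨ cong (_* F (x ∷ σ)) (χ-× (¬? (x ≟ v)) (omits? v σ)) ⟩
      χ (¬? (x ≟ v)) * χ (omits? v σ) * F (x ∷ σ)
        ≡⟨ *-assoc (χ (¬? (x ≟ v))) _ _ ⟩
      χ (¬? (x ≟ v)) * (χ (omits? v σ) * F (x ∷ σ)) ∎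

  admissible-∷ : (v : Fin m) (σ : Vec (Fin m) n) (c : Fin k) (u : Vec (Fin k) n) →
    Admissible (v ∷ σ) (c ∷ u) ⇔ (Omits v σ × Admissible σ u × ColouredAbove (suc (toℕ v)) c σ u)
  admissible-∷ v σ c u = mk⇔
    (λ (distinct , mono) →
      (λ j σj≡v → Finₚ.0≢1+n (sym (distinct (suc j) zero σj≡v))) ,
      ((λ i j eq → Finₚ.suc-injective (distinct (suc i) (suc j) eq)) , (λ i j i<j → mono (suc i) (suc j) (s≤s i<j))) ,
      (λ j v<σj → sym (mono zero (suc j) (s≤s z≤n) v<σj)))
    (λ (omits , (distinct , mono) , above) → distinct′ omits distinct , mono′ mono above)
    where
    distinct′ : Omits v σ → Distinct σ → Distinct (v ∷ σ)
    distinct′ omits distinct zero    zero    _  = refl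
    distinct′ omits distinct zero    (suc j) eq = contradiction (sym eq) (omits j)
    distinct′ omits distinct (suc i) zero    eq = contradiction eq (omits i)
    distinct′ omits distinct (suc i) (suc j) eq = cong suc (distinct i j eq)
    mono′ : MonochromeNonInversions σ u → ColouredAbove (suc (toℕ v)) c σ u → MonochromeNonInversions (v ∷ σ) (c ∷ u)
    mono′ mono above zero    (suc j) _         v<σj = sym (above j v<σj)
    mono′ mono above (suc i) (suc j) (s≤s i<j) σi<σj = mono i j i<j σi<σj

  χ-admissible-∷ : (v : Fin m) (σ : Vec (Fin m) n) (c : Fin k) (u : Vec (Fin k) n) →
    χ (admissible? (v ∷ σ) (c ∷ u)) ≡
    χ (omits? v σ) * (χ (admissible? σ u) * χ (colouredAbove? (suc (toℕ v)) c σ u))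
  χ-admissible-∷ v σ c u = begin
    χ (admissible? (v ∷ σ) (c ∷ u))
      ≡⟨ χ-cong (admissible-∷ v σ c u) (admissible? (v ∷ σ) (c ∷ u)) (omits? v σ ×-dec admissible? σ u ×-dec above?) ⟩
    χ (omits? v σ ×-dec admissible? σ u ×-dec above?)
      ≡⟨ trans (χ-× (omits? v σ) _) (cong (χ (omits? v σ) *_) (χ-× (admissible? σ u) above?)) ⟩
    χ (omits? v σ) * (χ (admissible? σ u) * χ above?) ∎
    where
    above? : Dec (ColouredAbove (suc (toℕ v)) c σ u)
    above? = colouredAbove? (suc (toℕ v)) c σ u

  toℕ-punchIn : (v : Fin (suc n)) (y : Fin n) →
    toℕ y < toℕ v × toℕ (punchIn v y) ≡ toℕ y ⊎ toℕ v ≤ toℕ y × toℕ (punchIn v y) ≡ suc (toℕ y)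
  toℕ-punchIn zero    y       = inj₂ (z≤n , refl)
  toℕ-punchIn (suc v) zero    = inj₁ (s≤s z≤n , refl)
  toℕ-punchIn (suc v) (suc y) with toℕ-punchIn v y
  ... | inj₁ (y<v , eq) = inj₁ (s≤s y<v , cong suc eq)
  ... | inj₂ (v≤y , eq) = inj₂ (s≤s v≤y , cong suc eq)

  toℕ-punchIn-≥ : (v : Fin (suc n)) (y : Fin n) → toℕ v ≤ toℕ y → toℕ (punchIn v y) ≡ suc (toℕ y)
  toℕ-punchIn-≥ v y v≤y with toℕ-punchIn v y
  ... | inj₁ (y<v , _) = contradiction (<-≤-trans y<v v≤y) (<-irrefl refl)
  ... | inj₂ (_ , eq)  = eq

  punchIn-mono-< : (v : Fin (suc n)) {x y : Fin n} → x Fin.< y → punchIn v x Fin.< punchIn v y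
  punchIn-mono-< v {x} {y} x<y =
    Finₚ.≤∧≢⇒< (Finₚ.punchIn-mono-≤ v x y (<⇒≤ x<y)) (λ eq → Finₚ.<⇒≢ x<y (Finₚ.punchIn-injective v x y eq))

  punchIn-cancel-< : (v : Fin (suc n)) {x y : Fin n} → punchIn v x Fin.< punchIn v y → x Fin.< y
  punchIn-cancel-< v {x} {y} px<py =
    Finₚ.≤∧≢⇒< (Finₚ.punchIn-cancel-≤ v x y (<⇒≤ px<py)) (λ { refl → <-irrefl refl px<py })

  ≤-punchIn : (v : Fin (suc n)) (y : Fin n) → toℕ y ≤ toℕ (punchIn v y)
  ≤-punchIn v y with toℕ-punchIn v y
  ... | inj₁ (_ , eq) = ≤-reflexive (sym eq)
  ... | inj₂ (_ , eq) = ≤-trans (n≤1+n _) (≤-reflexive (sym eq))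

  suc≤punchIn⇔≤ : (v : Fin (suc n)) (y : Fin n) → suc (toℕ v) ≤ toℕ (punchIn v y) ⇔ toℕ v ≤ toℕ y
  suc≤punchIn⇔≤ v y with toℕ-punchIn v y
  ... | inj₁ (y<v , eq) = mk⇔ (λ v<py → contradiction (<-trans v<py (subst (_< toℕ v) (sym eq) y<v)) (<-irrefl refl))
                              (λ v≤y → contradiction (<-≤-trans y<v v≤y) (<-irrefl refl))
  ... | inj₂ (v≤y , eq) = mk⇔ (λ _ → v≤y) (λ v≤y → subst (suc (toℕ v) ≤_) (sym eq) (s≤s v≤y))

  ≤punchIn⇒⊓≤ : ∀ a (v : Fin (suc n)) (y : Fin n) → a ≤ toℕ (punchIn v y) → a ⊓ toℕ v ≤ toℕ y
  ≤punchIn⇒⊓≤ a v y a≤py with toℕ-punchIn v y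
  ... | inj₁ (_ , eq)   = ≤-trans (m⊓n≤m a (toℕ v)) (subst (a ≤_) eq a≤py)
  ... | inj₂ (v≤y , _) = ≤-trans (m⊓n≤n a (toℕ v)) v≤y

  module _ (v : Fin (suc N)) (τ : Vec (Fin N) n) (u : Vec (Fin k) n) where

    private
      lookup-punchIn : ∀ j → lookup (Vec.map (punchIn v) τ) j ≡ punchIn v (lookup τ j)
      lookup-punchIn j = lookup-map j (punchIn v) τ

    admissible-punchIn : Admissible (Vec.map (punchIn v) τ) u ⇔ Admissible τ u
    admissible-punchIn = mk⇔
      (λ (distinct , mono) →
        (λ i j eq → distinct i j (trans (lookup-punchIn i) (trans (cong (punchIn v) eq) (sym (lookup-punchIn j))))) ,
        (λ i j i<j τi<τj → mono i j i<j
          (subst₂ Fin._<_ (sym (lookup-punchIn i)) (sym (lookup-punchIn j)) (punchIn-mono-< v τi<τj))))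
      (λ (distinct , mono) →
        (λ i j eq → distinct i j
          (Finₚ.punchIn-injective v _ _ (trans (sym (lookup-punchIn i)) (trans eq (lookup-punchIn j))))) ,
        (λ i j i<j pτi<pτj → mono i j i<j
          (punchIn-cancel-< v (subst₂ Fin._<_ (lookup-punchIn i) (lookup-punchIn j) pτi<pτj))))

    colouredAbove-punchIn : (c : Fin k) →
      ColouredAbove (suc (toℕ v)) c (Vec.map (punchIn v) τ) u ⇔ ColouredAbove (toℕ v) c τ u
    colouredAbove-punchIn c = mk⇔
      (λ above j v≤τj → above j (subst (λ x → suc (toℕ v) ≤ toℕ x) (sym (lookup-punchIn j))
                                       (Equivalence.from (suc≤punchIn⇔≤ v (lookup τ j)) v≤τj)))
      (λ above j v<pτj → above j (Equivalence.to (suc≤punchIn⇔≤ v (lookup τ j))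
                                    (subst (λ x → suc (toℕ v) ≤ toℕ x) (lookup-punchIn j) v<pτj)))

  distinct⇒surjective : (τ : Vec (Fin N) N) → Distinct τ → ∀ y → ∃ λ j → lookup τ j ≡ y
  distinct⇒surjective {suc N} τ distinct y with Finₚ.any? (λ j → lookup τ j ≟ y)
  ... | yes hit  = hit
  ... | no  miss = contradiction (Finₚ.injective⇒≤ squeezed-injective) (<-irrefl refl)
    where
    y≢ : ∀ j → y ≢ lookup τ j
    y≢ j eq = miss (j , sym eq)
    squeezed : Fin (suc N) → Fin N
    squeezed j = punchOut (y≢ j)
    squeezed-injective : ∀ {i j} → squeezed i ≡ squeezed j → i ≡ j
    squeezed-injective {i} {j} eq = distinct i j (Finₚ.punchOut-injective (y≢ i) (y≢ j) eq)

  -- If v < a, the value a − 1 occurs in the permutation τ; it lies above v, so it has colour c,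
  -- and punching in v turns it into a, so it also has colour c₀.
  colour-of-first : (v : Fin (suc N)) (τ : Vec (Fin N) N) (c c₀ : Fin k) (u : Vec (Fin k) N) →
    Distinct τ → ColouredAbove (toℕ v) c τ u → ColouredAbove a c₀ (v ∷ Vec.map (punchIn v) τ) (c ∷ u) →
    a ≤ N → c ≡ c₀
  colour-of-first {a = zero} v τ c c₀ u _ _ above₀ _ = above₀ zero z≤n
  colour-of-first {N} {a = suc a} v τ c c₀ u distinct above aboveₐ a<N with suc a ≤? toℕ v
  ... | yes a≤v = aboveₐ zero a≤v
  ... | no  a≰v = trans (sym (above j v≤τj)) (aboveₐ (suc j) a≤pτj)
    where
    y : Fin N
    y = fromℕ< a<N
    j : Fin N
    j = proj₁ (distinct⇒surjective τ distinct y)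
    τj≡a : toℕ (lookup τ j) ≡ a
    τj≡a = trans (cong toℕ (proj₂ (distinct⇒surjective τ distinct y))) (Finₚ.toℕ-fromℕ< a<N)
    v≤τj : toℕ v ≤ toℕ (lookup τ j)
    v≤τj = subst (toℕ v ≤_) (sym τj≡a) (≤-pred (≰⇒> a≰v))
    a≤pτj : suc a ≤ toℕ (lookup (Vec.map (punchIn v) τ) j)
    a≤pτj = ≤-reflexive (sym (begin
      toℕ (lookup (Vec.map (punchIn v) τ) j) ≡⟨ cong toℕ (lookup-map j (punchIn v) τ) ⟩
      toℕ (punchIn v (lookup τ j))           ≡⟨ toℕ-punchIn-≥ v (lookup τ j) v≤τj ⟩
      suc (toℕ (lookup τ j))                 ≡⟨ cong suc τj≡a ⟩
      suc a                                  ∎))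

  colouredAbove-∷ : (v : Fin (suc N)) (τ : Vec (Fin N) N) (c c₀ : Fin k) (u : Vec (Fin k) N) →
    Distinct τ → a ≤ N →
    (ColouredAbove (toℕ v) c τ u × ColouredAbove a c₀ (v ∷ Vec.map (punchIn v) τ) (c ∷ u))
      ⇔ (c ≡ c₀ × ColouredAbove (a ⊓ toℕ v) c₀ τ u)
  colouredAbove-∷ {a = a} v τ c c₀ u distinct a≤N = mk⇔ to from
    where
    lookup-punchIn : ∀ j → toℕ (lookup (Vec.map (punchIn v) τ) j) ≡ toℕ (punchIn v (lookup τ j))
    lookup-punchIn j = cong toℕ (lookup-map j (punchIn v) τ)

    to : ColouredAbove (toℕ v) c τ u × ColouredAbove a c₀ (v ∷ Vec.map (punchIn v) τ) (c ∷ u) →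
         c ≡ c₀ × ColouredAbove (a ⊓ toℕ v) c₀ τ u
    to (above , aboveₐ) = c≡c₀ , below
      where
      c≡c₀ : c ≡ c₀
      c≡c₀ = colour-of-first v τ c c₀ u distinct above aboveₐ a≤N
      below : ColouredAbove (a ⊓ toℕ v) c₀ τ u
      below j a⊓v≤τj with ⊓-sel a (toℕ v)
      ... | inj₁ a⊓v≡a = aboveₐ (suc j) (subst (a ≤_) (sym (lookup-punchIn j))
                           (≤-trans (subst (_≤ toℕ (lookup τ j)) a⊓v≡a a⊓v≤τj) (≤-punchIn v (lookup τ j))))
      ... | inj₂ a⊓v≡v = trans (above j (subst (_≤ toℕ (lookup τ j)) a⊓v≡v a⊓v≤τj)) c≡c₀

    from : c ≡ c₀ × ColouredAbove (a ⊓ toℕ v) c₀ τ u →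
           ColouredAbove (toℕ v) c τ u × ColouredAbove a c₀ (v ∷ Vec.map (punchIn v) τ) (c ∷ u)
    from (refl , below) = above , aboveₐ
      where
      above : ColouredAbove (toℕ v) c τ u
      above j v≤τj = below j (≤-trans (m⊓n≤n a (toℕ v)) v≤τj)
      aboveₐ : ColouredAbove a c (v ∷ Vec.map (punchIn v) τ) (c ∷ u)
      aboveₐ zero    _     = refl
      aboveₐ (suc j) a≤pτj = below j (≤punchIn⇒⊓≤ a v (lookup τ j) (subst (a ≤_) (lookup-punchIn j) a≤pτj))

  χ-colouredAbove-∷ : (v : Fin (suc N)) (τ : Vec (Fin N) N) (c c₀ : Fin k) (u : Vec (Fin k) N) →
    Distinct τ → a ≤ N →
    χ (colouredAbove? (toℕ v) c τ u) * χ (colouredAbove? a c₀ (v ∷ Vec.map (punchIn v) τ) (c ∷ u)) ≡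
    χ (c ≟ c₀) * χ (colouredAbove? (a ⊓ toℕ v) c₀ τ u)
  χ-colouredAbove-∷ {a = a} v τ c c₀ u distinct a≤N = begin
    χ aboveᵥ? * χ aboveₐ?      ≡⟨ χ-× aboveᵥ? aboveₐ? ⟨
    χ (aboveᵥ? ×-dec aboveₐ?)  ≡⟨ χ-cong (colouredAbove-∷ v τ c c₀ u distinct a≤N) _ (c ≟ c₀ ×-dec below?) ⟩
    χ (c ≟ c₀ ×-dec below?)    ≡⟨ χ-× (c ≟ c₀) below? ⟩
    χ (c ≟ c₀) * χ below?      ∎
    where
    aboveᵥ? : Dec (ColouredAbove (toℕ v) c τ u)
    aboveᵥ? = colouredAbove? (toℕ v) c τ u
    aboveₐ? : Dec (ColouredAbove a c₀ (v ∷ Vec.map (punchIn v) τ) (c ∷ u))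
    aboveₐ? = colouredAbove? a c₀ (v ∷ Vec.map (punchIn v) τ) (c ∷ u)
    below? : Dec (ColouredAbove (a ⊓ toℕ v) c₀ τ u)
    below? = colouredAbove? (a ⊓ toℕ v) c₀ τ u

  module _ (k : ℕ) where

    ∑Admissible : (N : ℕ) → (Vec (Fin N) N → Vec (Fin k) N → ℕ) → ℕ
    ∑Admissible N Q = sumWords N N λ σ → sumWords k N λ w → χ (admissible? σ w) * Q σ w

    ∑Admissible-cong : ∀ N (Q Q′ : Vec (Fin N) N → Vec (Fin k) N → ℕ) →
      (∀ σ w → Admissible σ w → Q σ w ≡ Q′ σ w) → ∑Admissible N Q ≡ ∑Admissible N Q′
    ∑Admissible-cong N Q Q′ Q≗Q′ = sumWords-cong λ σ → sumWords-cong λ w → χ-*-cong (admissible? σ w) (Q≗Q′ σ w)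

    *-distribˡ-∑Admissible : ∀ N c (Q : Vec (Fin N) N → Vec (Fin k) N → ℕ) →
      c * ∑Admissible N Q ≡ ∑Admissible N (λ σ w → c * Q σ w)
    *-distribˡ-∑Admissible N c Q =
      trans (*-distribˡ-sumWords {N} {N} c _) (sumWords-cong λ σ →
        trans (*-distribˡ-sumWords {k} {N} c _) (sumWords-cong λ w → *-left-comm c (χ (admissible? σ w)) (Q σ w)))
      where
      *-left-comm : ∀ x y z → x * (y * z) ≡ y * (x * z)
      *-left-comm = solve-∀

    ∑Admissible-∷ : ∀ N (Q : Vec (Fin (suc N)) (suc N) → Vec (Fin k) (suc N) → ℕ) →
      ∑Admissible (suc N) Q ≡ ∑[ v < suc N ] ∑[ c < k ]
        ∑Admissible N (λ τ u → χ (colouredAbove? (toℕ v) c τ u) * Q (v ∷ Vec.map (punchIn v) τ) (c ∷ u))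
    ∑Admissible-∷ N Q = sum-cong-≗ λ v → trans (sumWords-∑-comm {suc N} {N} {k} _) (sum-cong-≗ (first-entry v))
      where
      first-entry : ∀ v c →
        sumWords (suc N) N (λ σ → sumWords k N λ u → χ (admissible? (v ∷ σ) (c ∷ u)) * Q (v ∷ σ) (c ∷ u)) ≡
        ∑Admissible N (λ τ u → χ (colouredAbove? (toℕ v) c τ u) * Q (v ∷ Vec.map (punchIn v) τ) (c ∷ u))
      first-entry v c = begin
        sumWords (suc N) N (λ σ → sumWords k N λ u → χ (admissible? (v ∷ σ) (c ∷ u)) * Q (v ∷ σ) (c ∷ u))
          ≡⟨ sumWords-cong (λ σ → trans (sumWords-cong (split σ))
                                        (sym (*-distribˡ-sumWords {k} {N} (χ (omits? v σ)) _))) ⟩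
        sumWords (suc N) N (λ σ → χ (omits? v σ) * sumWords k N λ u → χ (admissible? σ u) * R σ u)
          ≡⟨ sumWords-omits {n = N} v _ ⟩
        sumWords N N (λ τ → sumWords k N λ u → χ (admissible? (Vec.map (punchIn v) τ) u) * R (Vec.map (punchIn v) τ) u)
          ≡⟨ sumWords-cong {N} {N} (λ τ → sumWords-cong {k} {N} λ u → cong₂ _*_
               (χ-cong (admissible-punchIn v τ u) (admissible? (Vec.map (punchIn v) τ) u) (admissible? τ u))
               (cong (_* Q (v ∷ Vec.map (punchIn v) τ) (c ∷ u)) (χ-cong (colouredAbove-punchIn v τ u c)
                 (colouredAbove? (suc (toℕ v)) c (Vec.map (punchIn v) τ) u) (colouredAbove? (toℕ v) c τ u)))) ⟩
        ∑Admissible N (λ τ u → χ (colouredAbove? (toℕ v) c τ u) * Q (v ∷ Vec.map (punchIn v) τ) (c ∷ u)) ∎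
        where
        R : Vec (Fin (suc N)) N → Vec (Fin k) N → ℕ
        R σ u = χ (colouredAbove? (suc (toℕ v)) c σ u) * Q (v ∷ σ) (c ∷ u)
        split : ∀ σ u →
          χ (admissible? (v ∷ σ) (c ∷ u)) * Q (v ∷ σ) (c ∷ u) ≡ χ (omits? v σ) * (χ (admissible? σ u) * R σ u)
        split σ u = trans (cong (_* Q (v ∷ σ) (c ∷ u)) (χ-admissible-∷ v σ c u))
          (*-assoc₃ (χ (omits? v σ)) (χ (admissible? σ u)) (χ (colouredAbove? (suc (toℕ v)) c σ u)) (Q (v ∷ σ) (c ∷ u)))
          where
          *-assoc₃ : ∀ w x y z → w * (x * y) * z ≡ w * (x * (y * z))
          *-assoc₃ = solve-∀

    ∑ColouredAbove : ℕ → ℕ → Fin k → ℕ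
    ∑ColouredAbove N a c = ∑Admissible N (λ σ w → χ (colouredAbove? a c σ w))

    colouredAboveCount : ℕ → ℕ → ℕ
    colouredAboveCount zero    a = 1
    colouredAboveCount (suc N) a with a ≤? N
    ... | yes _ = ∑[ v < suc N ] colouredAboveCount N (a ⊓ toℕ v)
    ... | no  _ = k * ∑[ v < suc N ] colouredAboveCount N (toℕ v)

    colouredAboveCount-≤ : ∀ N a → a ≤ N →
      colouredAboveCount (suc N) a ≡ ∑[ v < suc N ] colouredAboveCount N (a ⊓ toℕ v)
    colouredAboveCount-≤ N a a≤N with a ≤? N
    ... | yes _   = refl
    ... | no  a≰N = contradiction a≤N a≰N

    colouredAboveCount-> : ∀ N a → N < a →
      colouredAboveCount (suc N) a ≡ k * ∑[ v < suc N ] colouredAboveCount N (toℕ v)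
    colouredAboveCount-> N a N<a with a ≤? N
    ... | yes a≤N = contradiction a≤N (<⇒≱ N<a)
    ... | no  _   = refl

    ∑ColouredAbove-∷ : ∀ N a c₀ → a ≤ N →
      ∑ColouredAbove (suc N) a c₀ ≡ ∑[ v < suc N ] ∑ColouredAbove N (a ⊓ toℕ v) c₀
    ∑ColouredAbove-∷ N a c₀ a≤N =
      trans (∑Admissible-∷ N (λ σ w → χ (colouredAbove? a c₀ σ w))) (sum-cong-≗ {suc N} λ v → begin
        ∑[ c < k ] ∑Admissible N (λ τ u → χ (colouredAbove? (toℕ v) c τ u) *
                                          χ (colouredAbove? a c₀ (v ∷ Vec.map (punchIn v) τ) (c ∷ u)))
          ≡⟨ sum-cong-≗ {k} (λ c → trans
               (∑Admissible-cong N _ _ λ τ u (distinct , _) → χ-colouredAbove-∷ v τ c c₀ u distinct a≤N)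
               (sym (*-distribˡ-∑Admissible N (χ (c ≟ c₀)) _))) ⟩
        ∑[ c < k ] (χ (c ≟ c₀) * ∑ColouredAbove N (a ⊓ toℕ v) c₀)
          ≡⟨ ∑-δ c₀ _ ⟩
        ∑ColouredAbove N (a ⊓ toℕ v) c₀ ∎)

    ∑ColouredAbove-vacuous : ∀ N a c → N ≤ a → ∑ColouredAbove N a c ≡ ∑Admissible N (λ _ _ → 1)
    ∑ColouredAbove-vacuous N a c N≤a = ∑Admissible-cong N _ _ λ σ w _ → χ-yes (vacuous {σ} {w}) (colouredAbove? a c σ w)
      where
      vacuous : ∀ {σ : Vec (Fin N) N} {w} → ColouredAbove a c σ w
      vacuous {σ} j a≤σj = contradiction (≤-trans N≤a a≤σj) (<⇒≱ (Finₚ.toℕ<n (lookup σ j)))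

    ∑Admissible-suc-1 : ∀ N → (∀ a c → ∑ColouredAbove N a c ≡ colouredAboveCount N a) →
      ∑Admissible (suc N) (λ _ _ → 1) ≡ k * ∑[ v < suc N ] colouredAboveCount N (toℕ v)
    ∑Admissible-suc-1 N count = begin
      ∑Admissible (suc N) (λ _ _ → 1)
        ≡⟨ ∑Admissible-∷ N (λ _ _ → 1) ⟩
      ∑[ v < suc N ] ∑[ c < k ] ∑Admissible N (λ τ u → χ (colouredAbove? (toℕ v) c τ u) * 1)
        ≡⟨ sum-cong-≗ {suc N} (λ v → sum-cong-≗ {k} λ c →
             ∑Admissible-cong N _ (λ τ u → χ (colouredAbove? (toℕ v) c τ u)) (λ τ u _ → *-identityʳ _)) ⟩
      ∑[ v < suc N ] ∑[ c < k ] ∑ColouredAbove N (toℕ v) c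
        ≡⟨ sum-cong-≗ {suc N} (λ v → trans (sum-cong-≗ {k} (λ c → count (toℕ v) c)) (∑-const k _)) ⟩
      ∑[ v < suc N ] (k * colouredAboveCount N (toℕ v))
        ≡⟨ *-distribˡ-sum {suc N} k (λ v → colouredAboveCount N (toℕ v)) ⟨
      k * ∑[ v < suc N ] colouredAboveCount N (toℕ v) ∎

    ∑ColouredAbove≡colouredAboveCount : ∀ N a c → ∑ColouredAbove N a c ≡ colouredAboveCount N a
    ∑ColouredAbove≡colouredAboveCount zero    a c =
      cong₂ _*_ (χ-yes ((λ ()) , (λ ())) (admissible? {m = 0} {k = k} [] []))
                (χ-yes (λ ()) (colouredAbove? {m = 0} a c [] []))
    ∑ColouredAbove≡colouredAboveCount (suc N) a c with a ≤? N
    ... | yes a≤N = trans (∑ColouredAbove-∷ N a c a≤N)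
                          (sum-cong-≗ {suc N} λ v → ∑ColouredAbove≡colouredAboveCount N (a ⊓ toℕ v) c)
    ... | no  a≰N = trans (∑ColouredAbove-vacuous (suc N) a c (≰⇒> a≰N))
                          (∑Admissible-suc-1 N (∑ColouredAbove≡colouredAboveCount N))

    Av≡colouredAboveCount : ∀ N → Av N k ≡ colouredAboveCount N N
    Av≡colouredAboveCount N = begin
      Av N k
        ≡⟨ Av≡sumWords N k ⟩
      sumWords N N (λ σ → sumWords k N λ w → χ (good? (σ , w)))
        ≡⟨ sumWords-cong {N} {N} (λ σ → sumWords-cong {k} {N} (good≡admissible σ)) ⟩
      ∑Admissible N (λ _ _ → 1)
        ≡⟨ count N ⟩
      colouredAboveCount N N ∎
      where
      good≡admissible : ∀ σ w → χ (good? (σ , w)) ≡ χ (admissible? σ w) * 1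
      good≡admissible σ w = trans (χ-cong (good⇔admissible σ w) (good? (σ , w)) (admissible? σ w)) (sym (*-identityʳ _))
      count : ∀ N → ∑Admissible N (λ _ _ → 1) ≡ colouredAboveCount N N
      count zero = χ-yes ((λ ()) , (λ ())) (admissible? {m = 0} {k = k} [] [])
      count (suc N) = trans (∑Admissible-suc-1 N (∑ColouredAbove≡colouredAboveCount N))
                            (sym (colouredAboveCount-> N (suc N) ≤-refl))

  -- The coefficient recurrence

  positive : ℕ → ℕ
  positive zero    = 0
  positive (suc _) = 1

  oneℕ : ℕ → ℕ
  oneℕ zero    = 1
  oneℕ (suc _) = 0

  Cℕ : ℕ → ℕ
  Cℕ zero    = 0
  Cℕ (suc d) = factorial (suc d)

  antidiagonal-positive : ∀ n c → ∑[ a + b ≡ n ] (positive b * c) ≡ n * c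
  antidiagonal-positive zero    c = refl
  antidiagonal-positive (suc n) c = cong₂ _+_ (*-identityˡ c) (antidiagonal-positive n c)

  antidiagonal-oneℕ : ∀ n (f : ℕ → ℕ) → ∑[ a + b ≡ n ] (f a * oneℕ b) ≡ f n
  antidiagonal-oneℕ zero    f = *-identityʳ (f 0)
  antidiagonal-oneℕ (suc n) f = begin
    ∑[ a + b ≡ suc n ] (f a * oneℕ b)            ≡⟨ antidiagonal-last n (λ a b → f a * oneℕ b) ⟩
    ∑[ a + b ≡ n ] (f a * 0) + f (suc n) * 1    ≡⟨ cong₂ _+_ zeros (*-identityʳ (f (suc n))) ⟩
    0 + f (suc n)                                ∎
    where
    zeros : ∑[ a + b ≡ n ] (f a * 0) ≡ 0
    zeros = trans (antidiagonal-cong n (λ a _ → *-zeroʳ (f a))) (trans (antidiagonal-const n 0) (*-zeroʳ (suc n)))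

  antidiagonal-split : ∀ m s (h : ℕ → ℕ) →
    ∑[ v + e ≡ m + s ] h v ≡ ∑[ v + e ≡ m ] (positive e * h v) + ∑[ t + e ≡ s ] h (m + t)
  antidiagonal-split zero    s h = refl
  antidiagonal-split (suc m) s h =
    trans (cong (h 0 +_) (antidiagonal-split m s (h ∘ suc))) (+-assoc-one (h 0) _ _)
    where
    +-assoc-one : ∀ x y z → x + (y + z) ≡ 1 * x + y + z
    +-assoc-one = solve-∀

  module _ (K : ℕ) where

    T : ℕ → ℕ → ℕ
    T m s = colouredAboveCount (suc K) (s + m) m

    T-zero : ∀ m → T (suc m) 0 ≡ suc K * ∑[ v + e ≡ m ] T v e
    T-zero m = begin
      colouredAboveCount (suc K) (suc m) (suc m)
        ≡⟨ colouredAboveCount-> (suc K) m (suc m) ≤-refl ⟩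
      suc K * ∑[ v < suc m ] colouredAboveCount (suc K) m (toℕ v)
        ≡⟨ cong (suc K *_) (∑-toℕ≡antidiagonal m (colouredAboveCount (suc K) m)) ⟩
      suc K * ∑[ v + e ≡ m ] colouredAboveCount (suc K) m v
        ≡⟨ cong (suc K *_) (antidiagonal-cong′ m λ v e v+e≡m →
             cong (λ n → colouredAboveCount (suc K) n v) (trans (sym v+e≡m) (+-comm v e))) ⟩
      suc K * ∑[ v + e ≡ m ] T v e ∎

    T⁺ : ℕ → ℕ → ℕ
    T⁺ m s = ∑[ v + e ≡ m ] (positive e * T v (e + s))

    T-suc : ∀ m s → T m (suc s) ≡ T⁺ m s + suc s * T m s
    T-suc m s = begin
      colouredAboveCount (suc K) (suc (s + m)) m
        ≡⟨ colouredAboveCount-≤ (suc K) (s + m) m (m≤n+m m s) ⟩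
      ∑[ v < suc (s + m) ] count (m ⊓ toℕ v)
        ≡⟨ ∑-toℕ≡antidiagonal (s + m) (λ v → count (m ⊓ v)) ⟩
      ∑[ v + e ≡ s + m ] count (m ⊓ v)
        ≡⟨ cong (λ n → ∑[ v + e ≡ n ] count (m ⊓ v)) (+-comm s m) ⟩
      ∑[ v + e ≡ m + s ] count (m ⊓ v)
        ≡⟨ antidiagonal-split m s (λ v → count (m ⊓ v)) ⟩
      ∑[ v + e ≡ m ] (positive e * count (m ⊓ v)) + ∑[ t + e ≡ s ] count (m ⊓ (m + t))
        ≡⟨ cong₂ _+_ (antidiagonal-cong′ m below) (trans (antidiagonal-cong s above) (antidiagonal-const s (T m s))) ⟩
      T⁺ m s + suc s * T m s ∎
      where
      count : ℕ → ℕ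
      count = colouredAboveCount (suc K) (s + m)
      below : ∀ v e → v + e ≡ m → positive e * count (m ⊓ v) ≡ positive e * T v (e + s)
      below v zero    _     = refl
      below v (suc e) v+e≡m = cong (positive (suc e) *_) (begin
        count (m ⊓ v)
          ≡⟨ cong count (m≥n⇒m⊓n≡n (subst (v ≤_) v+e≡m (m≤m+n v (suc e)))) ⟩
        count v
          ≡⟨ cong (λ n → colouredAboveCount (suc K) n v) (trans (cong (s +_) (sym v+e≡m)) (rearrange s v e)) ⟩
        colouredAboveCount (suc K) (suc e + s + v) v ∎)
        where
        rearrange : ∀ s v e → s + (v + suc e) ≡ suc e + s + v
        rearrange = solve-∀
      above : ∀ t e → count (m ⊓ (m + t)) ≡ T m s
      above t _ = cong count (m≤n⇒m⊓n≡m (m≤m+n m t))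

    T⋆C : ℕ → ℕ → ℕ
    T⋆C m s = ∑[ j + d ≡ m ] (T j s * Cℕ d)

    T⁺⋆C : ℕ → ℕ → ℕ
    T⁺⋆C m s = ∑[ j + d ≡ m ] (T⁺ j s * Cℕ d)

    T⋆C-suc : ∀ m s → T⋆C m (suc s) ≡ T⁺⋆C m s + suc s * T⋆C m s
    T⋆C-suc m s = begin
      ∑[ j + d ≡ m ] (T j (suc s) * Cℕ d)
        ≡⟨ antidiagonal-cong m (λ j d → trans (cong (_* Cℕ d) (T-suc j s)) (distribute (T⁺ j s) (suc s) (T j s) (Cℕ d))) ⟩
      ∑[ j + d ≡ m ] (T⁺ j s * Cℕ d + suc s * (T j s * Cℕ d))
        ≡⟨ antidiagonal-distrib-+ m (λ j d → T⁺ j s * Cℕ d) (λ j d → suc s * (T j s * Cℕ d)) ⟩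
      T⁺⋆C m s + ∑[ j + d ≡ m ] (suc s * (T j s * Cℕ d))
        ≡⟨ cong (T⁺⋆C m s +_) (antidiagonal-*ˡ m (suc s) (λ j d → T j s * Cℕ d)) ⟩
      T⁺⋆C m s + suc s * T⋆C m s ∎
      where
      distribute : ∀ x c y z → (x + c * y) * z ≡ x * z + c * (y * z)
      distribute = solve-∀

    ClosedForm : ℕ → ℕ → Set
    ClosedForm m s = T m s ≡ factorial (s + m) + K * T⋆C m s

    -- The last line of the proof is T⋆C (suc m) 0 unfolded: its first term is T 0 0 * Cℕ (suc m) = 1 * (suc m)!.
    closedForm-zero : ∀ m → (∀ v e → v + e ≡ m → ClosedForm v e) → ClosedForm (suc m) 0
    closedForm-zero m ih = begin
      T (suc m) 0                                 ≡⟨ T-zero m ⟩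
      suc K * ∑[ v + e ≡ m ] T v e                ≡⟨ cong (suc K *_) ∑T-closedForm ⟩
      suc K * (factorial (suc m) + K * Y)         ≡⟨ arithmetic K (factorial (suc m)) Y Z sucK*Y≡Z ⟩
      factorial (suc m) + K * (1 * factorial (suc m) + Z) ∎
      where
      Y : ℕ
      Y = ∑[ r + d ≡ m ] ((∑[ j + e ≡ r ] T j e) * Cℕ d)
      Z : ℕ
      Z = ∑[ r + d ≡ m ] (T (suc r) 0 * Cℕ d)
      ∑T-closedForm : ∑[ v + e ≡ m ] T v e ≡ factorial (suc m) + K * Y
      ∑T-closedForm = begin
        ∑[ v + e ≡ m ] T v e
          ≡⟨ antidiagonal-cong′ m (λ v e v+e≡m → trans (ih v e v+e≡m)
               (cong (λ n → factorial n + K * T⋆C v e) (trans (+-comm e v) v+e≡m))) ⟩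
        ∑[ v + e ≡ m ] (factorial m + K * T⋆C v e)
          ≡⟨ antidiagonal-distrib-+ m (λ _ _ → factorial m) (λ v e → K * T⋆C v e) ⟩
        (∑[ v + e ≡ m ] factorial m) + ∑[ v + e ≡ m ] (K * T⋆C v e)
          ≡⟨ cong₂ _+_ (antidiagonal-const m (factorial m)) (antidiagonal-*ˡ m K T⋆C) ⟩
        factorial (suc m) + K * ∑[ v + e ≡ m ] T⋆C v e
          ≡⟨ cong (λ x → factorial (suc m) + K * x) (antidiagonal-reassoc m (λ j d e → T j e * Cℕ d)) ⟩
        factorial (suc m) + K * ∑[ r + d ≡ m ] ∑[ j + e ≡ r ] (T j e * Cℕ d)
          ≡⟨ cong (λ x → factorial (suc m) + K * x) (antidiagonal-cong m λ r d → antidiagonal-*ʳ r (Cℕ d) T) ⟩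
        factorial (suc m) + K * Y ∎
      sucK*Y≡Z : suc K * Y ≡ Z
      sucK*Y≡Z = begin
        suc K * Y
          ≡⟨ antidiagonal-*ˡ m (suc K) _ ⟨
        ∑[ r + d ≡ m ] (suc K * ((∑[ j + e ≡ r ] T j e) * Cℕ d))
          ≡⟨ antidiagonal-cong m (λ r d → trans (sym (*-assoc (suc K) (∑[ j + e ≡ r ] T j e) (Cℕ d)))
                                               (cong (_* Cℕ d) (sym (T-zero r)))) ⟩
        Z ∎
      arithmetic : ∀ K F Y Z → suc K * Y ≡ Z → suc K * (F + K * Y) ≡ F + K * (1 * F + Z)
      arithmetic K F Y Z refl = identity K F Y
        where
        identity : ∀ K F Y → suc K * (F + K * Y) ≡ F + K * (1 * F + suc K * Y)
        identity = solve-∀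

    T⁺-closedForm : ∀ m s → (∀ v e → v + e ≡ m → ClosedForm v (e + s)) →
      T⁺ m s ≡ m * factorial (s + m) + K * T⁺⋆C m s
    T⁺-closedForm m s ih = begin
      ∑[ v + e ≡ m ] (positive e * T v (e + s))
        ≡⟨ antidiagonal-cong′ m (λ v e v+e≡m → trans (cong (positive e *_) (ih v e v+e≡m))
             (cong (λ n → positive e * (factorial n + K * T⋆C v (e + s))) (rearrange e s v m v+e≡m))) ⟩
      ∑[ v + e ≡ m ] (positive e * (F + K * T⋆C v (e + s)))
        ≡⟨ antidiagonal-cong m (λ v e → distribute (positive e) F K (T⋆C v (e + s))) ⟩
      ∑[ v + e ≡ m ] (positive e * F + K * (positive e * T⋆C v (e + s)))
        ≡⟨ antidiagonal-distrib-+ m (λ _ e → positive e * F) (λ v e → K * (positive e * T⋆C v (e + s))) ⟩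
      (∑[ v + e ≡ m ] (positive e * F)) + ∑[ v + e ≡ m ] (K * (positive e * T⋆C v (e + s)))
        ≡⟨ cong₂ _+_ (antidiagonal-positive m F) (antidiagonal-*ˡ m K (λ v e → positive e * T⋆C v (e + s))) ⟩
      m * F + K * ∑[ v + e ≡ m ] (positive e * T⋆C v (e + s))
        ≡⟨ cong (λ x → m * F + K * x) (antidiagonal-cong m λ v e → antidiagonal-*ˡ v (positive e) _) ⟨
      m * F + K * ∑[ v + e ≡ m ] ∑[ j + d ≡ v ] (positive e * (T j (e + s) * Cℕ d))
        ≡⟨ cong (λ x → m * F + K * x) (antidiagonal-reassoc m (λ j d e → positive e * (T j (e + s) * Cℕ d))) ⟩
      m * F + K * ∑[ r + d ≡ m ] ∑[ j + e ≡ r ] (positive e * (T j (e + s) * Cℕ d))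
        ≡⟨ cong (λ x → m * F + K * x) (antidiagonal-cong m λ r d → trans
             (antidiagonal-cong r (λ j e → sym (*-assoc (positive e) (T j (e + s)) (Cℕ d))))
             (antidiagonal-*ʳ r (Cℕ d) (λ j e → positive e * T j (e + s)))) ⟩
      m * F + K * T⁺⋆C m s ∎
      where
      F : ℕ
      F = factorial (s + m)
      rearrange : ∀ e s v m → v + e ≡ m → e + s + v ≡ s + m
      rearrange e s v m refl = identity e s v
        where
        identity : ∀ e s v → e + s + v ≡ s + (v + e)
        identity = solve-∀
      distribute : ∀ p x c y → p * (x + c * y) ≡ p * x + c * (p * y)
      distribute = solve-∀

    closedForm-suc : ∀ m s → (∀ v e → v + e ≡ m → ClosedForm v (e + s)) → ClosedForm m s → ClosedForm m (suc s)
    closedForm-suc m s ih ihₛ = begin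
      T m (suc s)
        ≡⟨ T-suc m s ⟩
      T⁺ m s + suc s * T m s
        ≡⟨ cong₂ _+_ (T⁺-closedForm m s ih) (cong (suc s *_) ihₛ) ⟩
      m * F + K * T⁺⋆C m s + suc s * (F + K * T⋆C m s)
        ≡⟨ arithmetic m s F K (T⁺⋆C m s) (T⋆C m s) ⟩
      suc (s + m) * F + K * (T⁺⋆C m s + suc s * T⋆C m s)
        ≡⟨ cong (λ x → suc (s + m) * F + K * x) (T⋆C-suc m s) ⟨
      factorial (suc s + m) + K * T⋆C m (suc s) ∎
      where
      F : ℕ
      F = factorial (s + m)
      arithmetic : ∀ m s F K W Z → m * F + K * W + suc s * (F + K * Z) ≡ suc (s + m) * F + K * (W + suc s * Z)
      arithmetic = solve-∀

    closedForm : ∀ n m s → s + m ≡ n → ClosedForm m s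
    closedForm zero    zero    zero    _  = cong suc (sym (*-zeroʳ K))
    closedForm (suc n) (suc m) zero    eq = closedForm-zero m λ v e v+e≡m →
      closedForm n v e (trans (+-comm e v) (trans v+e≡m (suc-injective eq)))
    closedForm (suc n) m       (suc s) eq = closedForm-suc m s
      (λ v e v+e≡m → closedForm n v (e + s) (trans (rearrange e s v) (trans (cong (s +_) v+e≡m) (suc-injective eq))))
      (closedForm n m s (suc-injective eq))
      where
      rearrange : ∀ e s v → e + s + v ≡ s + (v + e)
      rearrange = solve-∀

    Av-recurrence : ∀ n → Av n (suc K) ≡ factorial n + K * ∑[ j + d ≡ n ] (Av j (suc K) * Cℕ d)
    Av-recurrence n = begin
      Av n (suc K)
        ≡⟨ Av≡colouredAboveCount (suc K) n ⟩
      T n 0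
        ≡⟨ closedForm n n 0 refl ⟩
      factorial n + K * T⋆C n 0
        ≡⟨ cong (λ x → factorial n + K * x) (antidiagonal-cong n λ j d → cong (_* Cℕ d) (Av≡colouredAboveCount (suc K) j)) ⟨
      factorial n + K * ∑[ j + d ≡ n ] (Av j (suc K) * Cℕ d) ∎

open Counting using (antidiagonal; oneℕ; Cℕ; antidiagonal-oneℕ; Av-recurrence)

open import Data.Integer using (ℤ; +_; _*_; _+_; _-_)
open import Data.Integer.Properties using (pos-+; pos-*; +-identityʳ; *-zeroʳ)
open import Data.Integer.Tactic.RingSolver using (solve-∀)
import Data.Nat as ℕ
open import Data.Nat using (zero; suc)
open import Data.List using (List; []; _∷_; map; foldr; upTo; applyUpTo)
open import Data.List.Properties using (map-cong; map-upTo)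
open import Relation.Binary.PropositionalEquality using (refl; sym; trans; cong; cong₂; module ≡-Reasoning)

open ≡-Reasoning

⊛-linearʳ : ∀ (f g h : PS) c n → (f ⊛ (λ m → g m - c * h m)) n ≡ (f ⊛ g) n - c * (f ⊛ h) n
⊛-linearʳ f g h c n = linear (upTo (suc n))
  where
  ∑ : (ℕ → ℤ) → List ℕ → ℤ
  ∑ t xs = foldr _+_ (+ 0) (map t xs)
  linear : ∀ xs → ∑ (λ i → f i * (g (n ∸ i) - c * h (n ∸ i))) xs
                ≡ ∑ (λ i → f i * g (n ∸ i)) xs - c * ∑ (λ i → f i * h (n ∸ i)) xs
  linear []       = sym (cong (_-_ (+ 0)) (*-zeroʳ c))
  linear (i ∷ xs) = trans (cong (_+_ (f i * (g (n ∸ i) - c * h (n ∸ i)))) (linear xs))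
                          (rearrange (f i) (g (n ∸ i)) (h (n ∸ i)) c _ _)
    where
    rearrange : ∀ a x y c X Y → a * (x - c * y) + (X - c * Y) ≡ (a * x + X) - c * (a * y + Y)
    rearrange = solve-∀

foldr-applyUpTo≡antidiagonal : ∀ n (H : ℕ → ℕ → ℕ) →
  foldr _+_ (+ 0) (applyUpTo (λ i → + H i (n ∸ i)) (suc n)) ≡ + antidiagonal n H
foldr-applyUpTo≡antidiagonal zero    H = +-identityʳ (+ H 0 0)
foldr-applyUpTo≡antidiagonal (suc n) H =
  trans (cong (_+_ (+ H 0 (suc n))) (foldr-applyUpTo≡antidiagonal n (λ a b → H (suc a) b)))
        (sym (pos-+ (H 0 (suc n)) _))

⊛-pos : ∀ {F G : PS} (f g : ℕ → ℕ) → (∀ m → F m ≡ + f m) → (∀ m → G m ≡ + g m) →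
        ∀ n → (F ⊛ G) n ≡ + (∑[ a + b ≡ n ] (f a ℕ.* g b))
⊛-pos {F} {G} f g F≡f G≡g n = begin
  foldr _+_ (+ 0) (map (λ i → F i * G (n ∸ i)) (upTo (suc n)))
    ≡⟨ cong (foldr _+_ (+ 0)) (map-cong (λ i → trans (cong₂ _*_ (F≡f i) (G≡g (n ∸ i))) (sym (pos-* (f i) _)))
                                        (upTo (suc n))) ⟩
  foldr _+_ (+ 0) (map (λ i → + (f i ℕ.* g (n ∸ i))) (upTo (suc n)))
    ≡⟨ cong (foldr _+_ (+ 0)) (map-upTo (λ i → + (f i ℕ.* g (n ∸ i))) (suc n)) ⟩
  foldr _+_ (+ 0) (applyUpTo (λ i → + (f i ℕ.* g (n ∸ i))) (suc n))
    ≡⟨ foldr-applyUpTo≡antidiagonal n (λ a b → f a ℕ.* g b) ⟩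
  + (∑[ a + b ≡ n ] (f a ℕ.* g b)) ∎

one≡oneℕ : ∀ m → one m ≡ + oneℕ m
one≡oneℕ zero    = refl
one≡oneℕ (suc m) = refl

C≡Cℕ : ∀ m → C m ≡ + Cℕ m
C≡Cℕ zero    = refl
C≡Cℕ (suc m) = refl

one+C≡factorial : ∀ n → one n + C n ≡ + factorial n
one+C≡factorial zero    = refl
one+C≡factorial (suc n) = refl

theorem9 : (k : ℕ) → 1 ≤ k → (n : ℕ) →
    (A k ⊛ (λ m → one m - (+ (k ∸ 1)) * C m)) n ≡ one n + C n
theorem9 (suc K) _ n = begin
  (A (suc K) ⊛ (λ m → one m - + K * C m)) n
    ≡⟨ ⊛-linearʳ (A (suc K)) one C (+ K) n ⟩
  (A (suc K) ⊛ one) n - + K * (A (suc K) ⊛ C) n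
    ≡⟨ cong₂ (λ x y → x - + K * y) (⊛-pos Av′ oneℕ (λ _ → refl) one≡oneℕ n)
                                   (⊛-pos Av′ Cℕ (λ _ → refl) C≡Cℕ n) ⟩
  + (∑[ a + b ≡ n ] (Av′ a ℕ.* oneℕ b)) - + K * + S
    ≡⟨ cong (λ x → + x - + K * + S) (trans (antidiagonal-oneℕ n Av′) (Av-recurrence K n)) ⟩
  + (factorial n ℕ.+ K ℕ.* S) - + K * + S
    ≡⟨ cong (λ x → x - + K * + S) (trans (pos-+ (factorial n) _) (cong (_+_ (+ factorial n)) (pos-* K S))) ⟩
  (+ factorial n + + K * + S) - + K * + S
    ≡⟨ cancel (+ factorial n) (+ K * + S) ⟩
  + factorial n
    ≡⟨ one+C≡factorial n ⟨
  one n + C n ∎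
  where
  Av′ : ℕ → ℕ
  Av′ j = Av j (suc K)
  S : ℕ
  S = ∑[ j + d ≡ n ] (Av′ j ℕ.* Cℕ d)
  cancel : ∀ x y → (x + y) - y ≡ x
  cancel = solve-∀
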